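{- Let $N\ge1$ and $n=\lfloor\log_2(N+1)\rfloor$. The total number of fires (over all vertices) is \[F(N)=\sum_{k=1}^{n-1}\left((k-1)2^k+1\right)c_k(N).\]
   Context: Unlabeled chip-firing on the infinite rooted binary tree (every vertex has a left and a right child) with a self-loop at the root; the root is on layer $1$ and children of a layer-$k$ vertex are on layer $k+1$. Start with $N$ indistinguishable chips at the root. A vertex with at least $3$ chips may fire, sending one chip to each child and one to its parent (the root keeps that chip via its self-loop). The process reaches a unique stable configuration, and the number of times each vertex fires is independent of the order of fires. $F(N)$ is the total number of fires performed until stabilization. Write $N+1$ in binary as $a_na_{n-1}\dots a_1a_0$ (so $a_n=1$) and set $c_i(N)=a_i+1$ for $0\le i\le n-1$. -}

module Defs where

open import Data.Nat using (ℕ; zero; suc; _+_; _*_; _∸_; _^_; _≤_; _<_)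
open import Data.Nat.DivMod using (_/_; _%_)
open import Data.Nat.Logarithm using (⌊log₂_⌋)
open import Data.Bool using (Bool; true; false)
import Data.Bool as Bool
open import Data.List using (List; []; _∷_; length)
open import Data.List.Properties using (≡-dec)
open import Relation.Nullary using (yes; no)
open import Relation.Binary.PropositionalEquality using (_≡_)

-- Vertices of the infinite rooted binary tree: the path from the root,
-- most recent step first.  [] is the root; the children of v are
-- true ∷ v and false ∷ v.
Vertex : Set
Vertex = List Bool

_≟V_ : (v w : Vertex) → Relation.Nullary.Dec (v ≡ w)
_≟V_ = ≡-dec Bool._≟_

-- parent; the root is its own parent (self-loop)
parent : Vertex → Vertex
parent []      = []
parent (_ ∷ v) = v

childInd : Vertex → Vertex → ℕ
childInd []      v = 0
childInd (_ ∷ w) v with w ≟V v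
... | yes _ = 1
... | no  _ = 0

eqInd : Vertex → Vertex → ℕ
eqInd w v with w ≟V v
... | yes _ = 1
... | no  _ = 0

Config : Set
Config = Vertex → ℕ

-- firing v: v loses 3 chips, each child and the parent of v gain one
-- (for the root, the parent chip returns to the root via the self-loop).
fire : Vertex → Config → Config
fire v c w with w ≟V v
... | yes _ = (c w ∸ 3) + eqInd w (parent v) + childInd w v
... | no  _ = c w + eqInd w (parent v) + childInd w v

data Legal : Config → List Vertex → Set where
  done : ∀ {c} → Legal c []
  step : ∀ {c v vs} → 3 ≤ c v → Legal (fire v c) vs → Legal c (v ∷ vs)

run : Config → List Vertex → Config
run c []       = c
run c (v ∷ vs) = run (fire v c) vs

Stable : Config → Set
Stable c = ∀ v → c v < 3

Stabilizing : Config → List Vertex → Set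
Stabilizing c vs = Legal c vs Data.Product.× Stable (run c vs)
  where import Data.Product

initial : ℕ → Config
initial N w with w ≟V []
... | yes _ = N
... | no  _ = 0

bit : ℕ → ℕ → ℕ
bit m zero    = m % 2
bit m (suc i) = bit (m / 2) i

-- c_i(N) = a_i + 1 where N+1 = Σ a_i 2^i
cc : ℕ → ℕ → ℕ
cc N i = bit (suc N) i + 1

sum1 : ℕ → (ℕ → ℕ) → ℕ
sum1 zero    f = 0
sum1 (suc m) f = sum1 m f + f (suc m)

formula : ℕ → ℕ
formula N = sum1 (⌊log₂ (suc N) ⌋ ∸ 1) (λ k → ((k ∸ 1) * 2 ^ k + 1) * cc N k)

-- By the least action principle a legal firing sequence never fires a vertex more often
-- than a stabilizing one, so all stabilizing sequences fire each vertex equally often and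
-- have the same length.  The initial configuration only depends on the depth of a vertex,
-- so whole layers can be fired at once, which reduces the process to a chain of layers.
-- Writing N = 1 + a + 2m, firing the root m times leaves 1 + a chips there and m chips on
-- each child; each child's subtree then behaves like the process started from m, with the
-- root firing right after every fire of layer 1 to pass the returned chips back down.
-- This gives F(N) = m + 2 F(m) + R(m) with R(m) = m - (c₀(m) + c₁(m) + ...) root fires,
-- and the digit formula satisfies the same recursion.
module Submission where

open import Defs
open import Data.Bool using (true; false)
open import Data.Empty using (⊥-elim)
open import Data.List using (List; []; _∷_; _++_; length; map; replicate; concatMap)
open import Data.List.Membership.Propositional using (_∈_)
open import Data.List.Membership.Propositional.Properties using (∈-∃++)
open import Data.List.Relation.Unary.Any using (here; there)
import Data.List.Properties as List
open import Data.Nat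
open import Data.Nat.Properties
open import Data.Nat.DivMod
open import Data.Nat.Logarithm
open import Data.Nat.Tactic.RingSolver using (solve-∀)
open import Data.Product using (Σ; _×_; _,_; proj₁; proj₂)
open import Function using (_∘_)
open import Relation.Nullary using (Dec; yes; no)
open import Relation.Binary.PropositionalEquality

eqInd-refl : ∀ v → eqInd v v ≡ 1
eqInd-refl v with v ≟V v
... | yes _   = refl
... | no v≢v = ⊥-elim (v≢v refl)

eqInd-≢ : ∀ {v w} → v ≢ w → eqInd v w ≡ 0
eqInd-≢ {v} {w} v≢w with v ≟V w
... | yes v≡w = ⊥-elim (v≢w v≡w)
... | no _    = refl

eqInd-∷ : ∀ b v w → eqInd (b ∷ v) (b ∷ w) ≡ eqInd v w
eqInd-∷ b v w = by-cases (v ≟V w)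
  where
  by-cases : Dec (v ≡ w) → eqInd (b ∷ v) (b ∷ w) ≡ eqInd v w
  by-cases (yes refl) = trans (eqInd-refl (b ∷ v)) (sym (eqInd-refl v))
  by-cases (no v≢w)   = trans (eqInd-≢ (v≢w ∘ List.∷-injectiveʳ)) (sym (eqInd-≢ v≢w))

childInd-∷ : ∀ b w v → childInd (b ∷ w) v ≡ eqInd w v
childInd-∷ b w v with w ≟V v
... | yes _ = refl
... | no _  = refl

childInd≡eqInd-parent : ∀ w b v → childInd w (b ∷ v) ≡ eqInd (parent w) (b ∷ v)
childInd≡eqInd-parent []      b v = refl
childInd≡eqInd-parent (c ∷ w) b v = childInd-∷ c w (b ∷ v)

inflow : Vertex → Vertex → ℕ
inflow w v = eqInd w (parent v) + childInd w v

inflow-neighbours : ∀ w v →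
  inflow w v ≡ eqInd (true ∷ w) v + eqInd (false ∷ w) v + eqInd (parent w) v
inflow-neighbours []      []          = refl
inflow-neighbours (b ∷ w) []          = childInd-∷ b w []
inflow-neighbours w       (true ∷ v)  = cong₂ _+_
  (trans (sym (+-identityʳ _)) (cong (_+ 0) (sym (eqInd-∷ true w v))))
  (childInd≡eqInd-parent w true v)
inflow-neighbours w       (false ∷ v) = cong₂ _+_
  (sym (eqInd-∷ false w v))
  (childInd≡eqInd-parent w false v)

fire-balance : ∀ v c w → 3 ≤ c v → fire v c w + 3 * eqInd w v ≡ c w + inflow w v
fire-balance v c w v-ready with w ≟V v
... | yes refl = trans (regroup (c w ∸ 3) _ _) (cong (_+ inflow w w) (m∸n+n≡m v-ready))
  where
  regroup : ∀ x p q → x + p + q + 3 * 1 ≡ (x + 3) + (p + q)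
  regroup = solve-∀
... | no _ = trans (+-identityʳ _) (+-assoc (c w) _ _)

fireCount : Vertex → List Vertex → ℕ
fireCount w []       = 0
fireCount w (v ∷ vs) = eqInd w v + fireCount w vs

fireCount-++ : ∀ w xs ys → fireCount w (xs ++ ys) ≡ fireCount w xs + fireCount w ys
fireCount-++ w []       ys = refl
fireCount-++ w (x ∷ xs) ys = trans (cong (eqInd w x +_) (fireCount-++ w xs ys)) (sym (+-assoc (eqInd w x) _ _))

received : Vertex → List Vertex → ℕ
received w vs = fireCount (true ∷ w) vs + fireCount (false ∷ w) vs + fireCount (parent w) vs

received-∷ : ∀ w v vs → received w (v ∷ vs) ≡ inflow w v + received w vs
received-∷ w v vs =
  trans (interchange (eqInd (true ∷ w) v) (fireCount (true ∷ w) vs) (eqInd (false ∷ w) v)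
                     (fireCount (false ∷ w) vs) (eqInd (parent w) v) (fireCount (parent w) vs))
        (cong (_+ received w vs) (sym (inflow-neighbours w v)))
  where
  interchange : ∀ a x b y c z → (a + x) + (b + y) + (c + z) ≡ (a + b + c) + (x + y + z)
  interchange = solve-∀

received-mono : ∀ xs ys → (∀ u → fireCount u xs ≤ fireCount u ys) → ∀ w → received w xs ≤ received w ys
received-mono xs ys xs≤ys w = +-mono-≤ (+-mono-≤ (xs≤ys _) (xs≤ys _)) (xs≤ys _)

run-balance : ∀ {c vs} → Legal c vs → ∀ w → run c vs w + 3 * fireCount w vs ≡ c w + received w vs
run-balance done w = refl
run-balance {c} {v ∷ vs} (step v-ready legal) w = begin
  run (fire v c) vs w + 3 * (eqInd w v + fireCount w vs)   ≡⟨ regroup (run (fire v c) vs w) (eqInd w v) (fireCount w vs) ⟩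
  (run (fire v c) vs w + 3 * fireCount w vs) + 3 * eqInd w v ≡⟨ cong (_+ 3 * eqInd w v) (run-balance legal w) ⟩
  fire v c w + received w vs + 3 * eqInd w v                ≡⟨ +-comm-middle (fire v c w) (received w vs) (3 * eqInd w v) ⟩
  (fire v c w + 3 * eqInd w v) + received w vs              ≡⟨ cong (_+ received w vs) (fire-balance v c w v-ready) ⟩
  c w + inflow w v + received w vs                          ≡⟨ +-assoc (c w) _ _ ⟩
  c w + (inflow w v + received w vs)                        ≡⟨ cong (c w +_) (received-∷ w v vs) ⟨
  c w + received w (v ∷ vs)                                 ∎
  where
  open ≡-Reasoning
  regroup : ∀ r e k → r + 3 * (e + k) ≡ (r + 3 * k) + 3 * e
  regroup = solve-∀
  +-comm-middle : ∀ f n e → f + n + e ≡ f + e + n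
  +-comm-middle = solve-∀

run-++ : ∀ c xs ys → run c (xs ++ ys) ≡ run (run c xs) ys
run-++ c []       ys = refl
run-++ c (x ∷ xs) ys = run-++ (fire x c) xs ys

Legal-++ : ∀ {c xs ys} → Legal c xs → Legal (run c xs) ys → Legal c (xs ++ ys)
Legal-++ done                 legal = legal
Legal-++ (step ready legal₁) legal = step ready (Legal-++ legal₁ legal)

-- Otherwise the balance equations would leave v with at most 2 chips after xs.
ready⇒fewer-fires : ∀ {c xs ys v} → Legal c xs → Legal c ys → Stable (run c ys) →
  (∀ u → fireCount u xs ≤ fireCount u ys) → 3 ≤ run c xs v → fireCount v xs < fireCount v ys
ready⇒fewer-fires {c} {xs} {ys} {v} legal-xs legal-ys stable xs≤ys ready =
  ≰⇒> λ ys≤xs → <⇒≱ ready (+-cancelʳ-≤ (3 * fireCount v xs) _ _ (begin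
    run c xs v + 3 * fireCount v xs ≡⟨ run-balance legal-xs v ⟩
    c v + received v xs             ≤⟨ +-monoʳ-≤ (c v) (received-mono xs ys xs≤ys v) ⟩
    c v + received v ys             ≡⟨ run-balance legal-ys v ⟨
    run c ys v + 3 * fireCount v ys ≤⟨ +-mono-≤ (≤-pred (stable v)) (*-monoʳ-≤ 3 ys≤xs) ⟩
    2 + 3 * fireCount v xs          ∎))
  where open ≤-Reasoning

least-action : ∀ {c xs ys} → Legal c xs → Legal c ys → Stable (run c ys) →
  ∀ w → fireCount w xs ≤ fireCount w ys
least-action {c} {xs} {ys} legal-xs legal-ys stable = extend [] xs done legal-xs (λ _ → z≤n)
  where
  extend : ∀ pre rest → Legal c pre → Legal (run c pre) rest →
    (∀ u → fireCount u pre ≤ fireCount u ys) → ∀ w → fireCount w (pre ++ rest) ≤ fireCount w ys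
  extend pre [] _ _ pre≤ys w =
    subst (λ l → fireCount w l ≤ fireCount w ys) (sym (List.++-identityʳ pre)) (pre≤ys w)
  extend pre (v ∷ rest) legal-pre (step ready legal-rest) pre≤ys w =
    subst (λ l → fireCount w l ≤ fireCount w ys) (List.++-assoc pre (v ∷ []) rest)
      (extend (pre ++ v ∷ []) rest
        (Legal-++ legal-pre (step ready done))
        (subst (λ d → Legal d rest) (sym (run-++ c pre (v ∷ []))) legal-rest)
        pre+v≤ys w)
    where
    fewer : fireCount v pre < fireCount v ys
    fewer = ready⇒fewer-fires legal-pre legal-ys stable pre≤ys ready
    pre+v≤ys : ∀ u → fireCount u (pre ++ v ∷ []) ≤ fireCount u ys
    pre+v≤ys u = subst (_≤ fireCount u ys) (sym (fireCount-++ u pre (v ∷ []))) (by-cases (u ≟V v))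
      where
      by-cases : Dec (u ≡ v) → fireCount u pre + (eqInd u v + 0) ≤ fireCount u ys
      by-cases (yes refl) rewrite eqInd-refl u = subst (_≤ fireCount u ys) (+-comm 1 _) fewer
      by-cases (no u≢v)   rewrite eqInd-≢ u≢v  = subst (_≤ fireCount u ys) (sym (+-identityʳ _)) (pre≤ys u)

fireCount-pos⇒∈ : ∀ v vs → 1 ≤ fireCount v vs → v ∈ vs
fireCount-pos⇒∈ v (u ∷ us) pos = by-cases (v ≟V u)
  where
  by-cases : Dec (v ≡ u) → v ∈ u ∷ us
  by-cases (yes refl) = here refl
  by-cases (no v≢u)   = there (fireCount-pos⇒∈ v us (subst (λ e → 1 ≤ e + fireCount v us) (eqInd-≢ v≢u) pos))

fireCount-middle : ∀ w ys v zs → fireCount w (ys ++ v ∷ zs) ≡ eqInd w v + fireCount w (ys ++ zs)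
fireCount-middle w ys v zs = begin
  fireCount w (ys ++ v ∷ zs)                          ≡⟨ fireCount-++ w ys (v ∷ zs) ⟩
  fireCount w ys + (eqInd w v + fireCount w zs)       ≡⟨ +-comm-left (fireCount w ys) (eqInd w v) _ ⟩
  eqInd w v + (fireCount w ys + fireCount w zs)       ≡⟨ cong (eqInd w v +_) (fireCount-++ w ys zs) ⟨
  eqInd w v + fireCount w (ys ++ zs)                  ∎
  where
  open ≡-Reasoning
  +-comm-left : ∀ a b c → a + (b + c) ≡ b + (a + c)
  +-comm-left = solve-∀

fireCounts⇒length : ∀ xs ys → (∀ w → fireCount w xs ≡ fireCount w ys) → length xs ≡ length ys
fireCounts⇒length [] []       _    = refl
fireCounts⇒length [] (u ∷ us) same = ⊥-elim (0≢1+n (trans (same u) (cong (_+ fireCount u us) (eqInd-refl u))))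
fireCounts⇒length (x ∷ xs) ys same
  with ∈-∃++ (fireCount-pos⇒∈ x ys (subst (1 ≤_) (trans (cong (_+ fireCount x xs) (sym (eqInd-refl x))) (same x)) (s≤s z≤n)))
... | ys₁ , ys₂ , refl = trans
  (cong suc (fireCounts⇒length xs (ys₁ ++ ys₂) λ w →
    +-cancelˡ-≡ (eqInd w x) _ _ (trans (same w) (fireCount-middle w ys₁ x ys₂))))
  (sym (List.length-++-sucʳ ys₁ x ys₂))

stabilizing-length : ∀ {c xs ys} → Stabilizing c xs → Stabilizing c ys → length xs ≡ length ys
stabilizing-length {xs = xs} {ys} (legal-xs , stable-xs) (legal-ys , stable-ys) =
  fireCounts⇒length xs ys λ w →
    ≤-antisym (least-action legal-xs legal-ys stable-ys w) (least-action legal-ys legal-xs stable-xs w)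

δ : ℕ → ℕ → ℕ
δ zero    zero    = 1
δ zero    (suc _) = 0
δ (suc _) zero    = 0
δ (suc j) (suc k) = δ j k

*δ≤ : ∀ m j k (g : ℕ → ℕ) → m ≤ g k → m * δ j k ≤ g j
*δ≤ m zero    zero    g m≤g = ≤-trans (≤-reflexive (*-identityʳ m)) m≤g
*δ≤ m zero    (suc k) g _   = ≤-trans (≤-reflexive (*-zeroʳ m)) z≤n
*δ≤ m (suc j) zero    g _   = ≤-trans (≤-reflexive (*-zeroʳ m)) z≤n
*δ≤ m (suc j) (suc k) g m≤g = *δ≤ m j k (g ∘ suc) m≤g

layer : ℕ → List Vertex
layer zero    = [] ∷ []
layer (suc k) = map (true ∷_) (layer k) ++ map (false ∷_) (layer k)

length-layer : ∀ k → length (layer k) ≡ 2 ^ k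
length-layer zero    = refl
length-layer (suc k) = begin
  length (map (true ∷_) (layer k) ++ map (false ∷_) (layer k))
    ≡⟨ List.length-++ (map (true ∷_) (layer k)) ⟩
  length (map (true ∷_) (layer k)) + length (map (false ∷_) (layer k))
    ≡⟨ cong₂ _+_ (List.length-map (true ∷_) (layer k)) (List.length-map (false ∷_) (layer k)) ⟩
  length (layer k) + length (layer k)
    ≡⟨ cong (λ n → n + n) (length-layer k) ⟩
  2 ^ k + 2 ^ k
    ≡⟨ cong (2 ^ k +_) (+-identityʳ (2 ^ k)) ⟨
  2 ^ suc k ∎
  where open ≡-Reasoning

fireCount-map-root : ∀ b vs → fireCount [] (map (b ∷_) vs) ≡ 0
fireCount-map-root b []       = refl
fireCount-map-root b (v ∷ vs) = fireCount-map-root b vs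

fireCount-map-∷ : ∀ b w vs → fireCount (b ∷ w) (map (b ∷_) vs) ≡ fireCount w vs
fireCount-map-∷ b w []       = refl
fireCount-map-∷ b w (v ∷ vs) = cong₂ _+_ (eqInd-∷ b w v) (fireCount-map-∷ b w vs)

fireCount-map-true-false : ∀ w vs → fireCount (true ∷ w) (map (false ∷_) vs) ≡ 0
fireCount-map-true-false w []       = refl
fireCount-map-true-false w (v ∷ vs) = fireCount-map-true-false w vs

fireCount-map-false-true : ∀ w vs → fireCount (false ∷ w) (map (true ∷_) vs) ≡ 0
fireCount-map-false-true w []       = refl
fireCount-map-false-true w (v ∷ vs) = fireCount-map-false-true w vs

fireCount-layer : ∀ k w → fireCount w (layer k) ≡ δ (length w) k
fireCount-layer zero    []      = refl
fireCount-layer zero    (_ ∷ _) = refl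
fireCount-layer (suc k) w =
  trans (fireCount-++ w (map (true ∷_) (layer k)) (map (false ∷_) (layer k))) (by-head w)
  where
  by-head : ∀ w → fireCount w (map (true ∷_) (layer k)) + fireCount w (map (false ∷_) (layer k))
                  ≡ δ (length w) (suc k)
  by-head []          = cong₂ _+_ (fireCount-map-root true (layer k)) (fireCount-map-root false (layer k))
  by-head (true ∷ w)  = trans (cong₂ _+_ (fireCount-map-∷ true w (layer k)) (fireCount-map-true-false w (layer k)))
                              (trans (+-identityʳ _) (fireCount-layer k w))
  by-head (false ∷ w) = trans (cong₂ _+_ (fireCount-map-false-true w (layer k)) (fireCount-map-∷ false w (layer k)))
                              (fireCount-layer k w)

layerInflow : ℕ → ℕ → ℕ
layerInflow j k = δ (suc j) k + δ (suc j) k + δ (pred j) k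

received-layer : ∀ k w → received w (layer k) ≡ layerInflow (length w) k
received-layer k []
  rewrite fireCount-layer k (true ∷ []) | fireCount-layer k (false ∷ []) | fireCount-layer k [] = refl
received-layer k (b ∷ w)
  rewrite fireCount-layer k (true ∷ b ∷ w) | fireCount-layer k (false ∷ b ∷ w) | fireCount-layer k w = refl

-- Chips per vertex on each layer (layer j = vertices of depth j); fireLayer k fires
-- all 2 ^ k vertices of layer k.
LayerConfig : Set
LayerConfig = ℕ → ℕ

fireLayer : ℕ → LayerConfig → LayerConfig
fireLayer zero          g zero                = g 0 ∸ 2
fireLayer zero          g (suc zero)          = suc (g 1)
fireLayer zero          g (suc (suc j))       = g (suc (suc j))
fireLayer (suc zero)    g zero                = g 0 + 2
fireLayer (suc zero)    g (suc zero)          = g 1 ∸ 3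
fireLayer (suc zero)    g (suc (suc zero))    = suc (g 2)
fireLayer (suc zero)    g (suc (suc (suc j))) = g (suc (suc (suc j)))
fireLayer (suc (suc k)) g zero                = g 0
fireLayer (suc (suc k)) g (suc j)             = fireLayer (suc k) (g ∘ suc) j

fireLayer-balance : ∀ k g j → 3 ≤ g k → fireLayer k g j + 3 * δ j k ≡ g j + layerInflow j k
fireLayer-balance zero          g zero                ready =
  trans (+-suc (g 0 ∸ 2) 2) (trans (cong suc (m∸n+n≡m (≤-trans (n≤1+n 2) ready))) (+-comm 1 (g 0)))
fireLayer-balance zero          g (suc zero)          ready = trans (+-identityʳ _) (+-comm 1 (g 1))
fireLayer-balance zero          g (suc (suc j))       ready = refl
fireLayer-balance (suc zero)    g zero                ready = +-identityʳ (g 0 + 2)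
fireLayer-balance (suc zero)    g (suc zero)          ready = trans (m∸n+n≡m ready) (sym (+-identityʳ (g 1)))
fireLayer-balance (suc zero)    g (suc (suc zero))    ready = trans (+-identityʳ _) (+-comm 1 (g 2))
fireLayer-balance (suc zero)    g (suc (suc (suc j))) ready = refl
fireLayer-balance (suc (suc k)) g zero                ready = refl
fireLayer-balance (suc (suc k)) g (suc zero)          ready = fireLayer-balance (suc k) (g ∘ suc) zero ready
fireLayer-balance (suc (suc k)) g (suc (suc j))       ready = fireLayer-balance (suc k) (g ∘ suc) (suc j) ready

data LayerLegal : LayerConfig → List ℕ → Set where
  done : ∀ {g} → LayerLegal g []
  step : ∀ {g k ks} → 3 ≤ g k → LayerLegal (fireLayer k g) ks → LayerLegal g (k ∷ ks)

runLayers : LayerConfig → List ℕ → LayerConfig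
runLayers g []       = g
runLayers g (k ∷ ks) = runLayers (fireLayer k g) ks

Layered : Config → LayerConfig → Set
Layered c g = ∀ w → c w ≡ g (length w)

-- Firing only adds chips to vertices that do not fire, so enough initial chips suffice.
enough-chips⇒Legal : ∀ vs c → (∀ w → 3 * fireCount w vs ≤ c w) → Legal c vs
enough-chips⇒Legal []       c enough = done
enough-chips⇒Legal (v ∷ vs) c enough = step ready (enough-chips⇒Legal vs (fire v c) enough′)
  where
  ready : 3 ≤ c v
  ready = ≤-trans (m≤m*n 3 (suc (fireCount v vs)))
                  (subst (λ e → 3 * (e + fireCount v vs) ≤ c v) (eqInd-refl v) (enough v))
  enough′ : ∀ w → 3 * fireCount w vs ≤ fire v c w
  enough′ w = +-cancelʳ-≤ (3 * eqInd w v) _ _ (begin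
    3 * fireCount w vs + 3 * eqInd w v ≡⟨ *-distribˡ-+ 3 (fireCount w vs) (eqInd w v) ⟨
    3 * (fireCount w vs + eqInd w v)   ≡⟨ cong (3 *_) (+-comm (fireCount w vs) (eqInd w v)) ⟩
    3 * (eqInd w v + fireCount w vs)   ≤⟨ enough w ⟩
    c w                                ≤⟨ m≤m+n (c w) (inflow w v) ⟩
    c w + inflow w v                   ≡⟨ fire-balance v c w ready ⟨
    fire v c w + 3 * eqInd w v         ∎)
    where open ≤-Reasoning

fire-layer : ∀ {c g} k → Layered c g → 3 ≤ g k →
  Legal c (layer k) × Layered (run c (layer k)) (fireLayer k g)
fire-layer {c} {g} k layered ready = legal , layered′
  where
  legal : Legal c (layer k)
  legal = enough-chips⇒Legal (layer k) c λ w →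
    subst (_≤ c w) (cong (3 *_) (sym (fireCount-layer k w)))
          (subst (3 * δ (length w) k ≤_) (sym (layered w)) (*δ≤ 3 (length w) k g ready))
  layered′ : Layered (run c (layer k)) (fireLayer k g)
  layered′ w = +-cancelʳ-≡ (3 * δ (length w) k) _ _ (begin
    run c (layer k) w + 3 * δ (length w) k         ≡⟨ cong (λ n → run c (layer k) w + 3 * n) (fireCount-layer k w) ⟨
    run c (layer k) w + 3 * fireCount w (layer k)  ≡⟨ run-balance legal w ⟩
    c w + received w (layer k)                     ≡⟨ cong₂ _+_ (layered w) (received-layer k w) ⟩
    g (length w) + layerInflow (length w) k        ≡⟨ fireLayer-balance k g (length w) ready ⟨
    fireLayer k g (length w) + 3 * δ (length w) k  ∎)
    where open ≡-Reasoning

simulate : ∀ {c g ks} → Layered c g → LayerLegal g ks →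
  Legal c (concatMap layer ks) × Layered (run c (concatMap layer ks)) (runLayers g ks)
simulate layered done = done , layered
simulate {c} {ks = k ∷ ks} layered (step ready legal)
  with fire-layer k layered ready
... | legal-k , layered-k with simulate layered-k legal
...   | legal-ks , layered-ks =
  Legal-++ legal-k legal-ks ,
  λ w → trans (cong (λ d → d w) (run-++ c (layer k) (concatMap layer ks))) (layered-ks w)

weight : List ℕ → ℕ
weight []       = 0
weight (k ∷ ks) = 2 ^ k + weight ks

length-concatMap-layer : ∀ ks → length (concatMap layer ks) ≡ weight ks
length-concatMap-layer []       = refl
length-concatMap-layer (k ∷ ks) =
  trans (List.length-++ (layer k)) (cong₂ _+_ (length-layer k) (length-concatMap-layer ks))

fireLayer-cong : ∀ k {g h} → g ≗ h → fireLayer k g ≗ fireLayer k h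
fireLayer-cong zero          g≗h zero                = cong (_∸ 2) (g≗h 0)
fireLayer-cong zero          g≗h (suc zero)          = cong suc (g≗h 1)
fireLayer-cong zero          g≗h (suc (suc j))       = g≗h _
fireLayer-cong (suc zero)    g≗h zero                = cong (_+ 2) (g≗h 0)
fireLayer-cong (suc zero)    g≗h (suc zero)          = cong (_∸ 3) (g≗h 1)
fireLayer-cong (suc zero)    g≗h (suc (suc zero))    = cong suc (g≗h 2)
fireLayer-cong (suc zero)    g≗h (suc (suc (suc j))) = g≗h _
fireLayer-cong (suc (suc k)) g≗h zero                = g≗h 0
fireLayer-cong (suc (suc k)) g≗h (suc j)             = fireLayer-cong (suc k) (g≗h ∘ suc) j

LayerLegal-cong : ∀ {g h ks} → g ≗ h → LayerLegal g ks → LayerLegal h ks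
LayerLegal-cong g≗h done = done
LayerLegal-cong {ks = k ∷ _} g≗h (step ready legal) =
  step (subst (3 ≤_) (g≗h k) ready) (LayerLegal-cong (fireLayer-cong k g≗h) legal)

runLayers-cong : ∀ {g h} ks → g ≗ h → runLayers g ks ≗ runLayers h ks
runLayers-cong []       g≗h = g≗h
runLayers-cong (k ∷ ks) g≗h = runLayers-cong ks (fireLayer-cong k g≗h)

runLayers-++ : ∀ g ks ls → runLayers g (ks ++ ls) ≡ runLayers (runLayers g ks) ls
runLayers-++ g []       ls = refl
runLayers-++ g (k ∷ ks) ls = runLayers-++ (fireLayer k g) ks ls

LayerLegal-++ : ∀ {g ks ls} → LayerLegal g ks → LayerLegal (runLayers g ks) ls → LayerLegal g (ks ++ ls)
LayerLegal-++ done                 legal = legal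
LayerLegal-++ (step ready legal₁) legal = step ready (LayerLegal-++ legal₁ legal)

Reaches : LayerConfig → List ℕ → LayerConfig → Set
Reaches g ks h = LayerLegal g ks × runLayers g ks ≗ h

Reaches-fire : ∀ {g k ks h} → 3 ≤ g k → Reaches (fireLayer k g) ks h → Reaches g (k ∷ ks) h
Reaches-fire ready (legal , final) = step ready legal , final

Reaches-cong : ∀ {g g′ ks h} → g ≗ g′ → Reaches g′ ks h → Reaches g ks h
Reaches-cong {ks = ks} g≗g′ (legal , final) =
  LayerLegal-cong (sym ∘ g≗g′) legal , λ j → trans (runLayers-cong ks g≗g′ j) (final j)

Reaches-++ : ∀ {g ks h ls i} → Reaches g ks h → Reaches h ls i → Reaches g (ks ++ ls) i
Reaches-++ {g} {ks} {ls = ls} (legal₁ , final₁) (legal₂ , final₂) =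
  LayerLegal-++ legal₁ (LayerLegal-cong (sym ∘ final₁) legal₂) ,
  λ j → trans (cong (λ d → d j) (runLayers-++ g ks ls)) (trans (runLayers-cong ls final₁ j) (final₂ j))

withRoot : ℕ → LayerConfig → LayerConfig
withRoot r g zero    = r
withRoot r g (suc j) = g j

-- A fire of the subtree's root is simulated by firing layer 1 and then the root,
-- which gets back the two chips it needs.
lift : List ℕ → List ℕ
lift []           = []
lift (zero ∷ ks)  = 1 ∷ 0 ∷ lift ks
lift (suc k ∷ ks) = suc (suc k) ∷ lift ks

lift-correct : ∀ {g h r} ks → 1 ≤ r → Reaches g ks h → Reaches (withRoot r g) (lift ks) (withRoot r h)
lift-correct [] r≥1 (done , final) = done , λ { zero → refl ; (suc j) → final j }
lift-correct {g} {r = r} (zero ∷ ks) r≥1 (step ready legal , final) =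
  Reaches-fire ready (Reaches-fire (+-monoˡ-≤ 2 r≥1) (Reaches-cong commute (lift-correct ks r≥1 (legal , final))))
  where
  commute : fireLayer 0 (fireLayer 1 (withRoot r g)) ≗ withRoot r (fireLayer 0 g)
  commute zero                = m+n∸n≡m r 2
  commute (suc zero)          = sym (+-∸-assoc 1 ready)
  commute (suc (suc zero))    = refl
  commute (suc (suc (suc j))) = refl
lift-correct {g} {r = r} (suc k ∷ ks) r≥1 (step ready legal , final) =
  Reaches-fire ready (Reaches-cong commute (lift-correct ks r≥1 (legal , final)))
  where
  commute : fireLayer (suc (suc k)) (withRoot r g) ≗ withRoot r (fireLayer (suc k) g)
  commute zero    = refl
  commute (suc j) = refl

twoLayers : ℕ → ℕ → LayerConfig
twoLayers x y = withRoot x (withRoot y λ _ → 0)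

fireRoot-repeatedly : ∀ m r y → 1 ≤ r → Reaches (twoLayers (r + 2 * m) y) (replicate m 0) (twoLayers r (y + m))
fireRoot-repeatedly zero r y r≥1 = done , λ
  { zero → +-identityʳ r ; (suc zero) → sym (+-identityʳ y) ; (suc (suc j)) → refl }
fireRoot-repeatedly (suc m) r y r≥1 with fireRoot-repeatedly m r (suc y) r≥1
... | legal , final = Reaches-fire ready (Reaches-cong fired (legal , λ j → trans (final j) (shuffle j)))
  where
  ready : 3 ≤ r + 2 * suc m
  ready = +-mono-≤ r≥1 (m≤m*n 2 (suc m))
  fired : fireLayer 0 (twoLayers (r + 2 * suc m) y) ≗ twoLayers (r + 2 * m) (suc y)
  fired zero          = trans (cong (λ n → r + n ∸ 2) (*-suc 2 m)) (+-∸-assoc r (m≤m+n 2 (2 * m)))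
  fired (suc zero)    = refl
  fired (suc (suc j)) = refl
  shuffle : twoLayers r (suc y + m) ≗ twoLayers r (y + suc m)
  shuffle zero          = refl
  shuffle (suc zero)    = sym (+-suc y m)
  shuffle (suc (suc j)) = refl

-- N = 1 + a + 2m means N + 1 = a + 2(m + 1): a is the last binary digit of N + 1.
data Binary : ℕ → Set where
  zero : Binary 0
  cons : ∀ {a m} → a ≤ 1 → Binary m → Binary (suc (a + 2 * m))

binary-suc : ∀ {N} → Binary N → Binary (suc N)
binary-suc zero                       = cons z≤n zero
binary-suc (cons z≤n b)               = cons ≤-refl b
binary-suc (cons {m = m} (s≤s z≤n) b) = subst Binary (cong suc (*-suc 2 m)) (cons z≤n (binary-suc b))

binary : ∀ N → Binary N
binary zero    = zero
binary (suc N) = binary-suc (binary N)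

[a+2q]%2≡a : ∀ {a} q → a ≤ 1 → (a + 2 * q) % 2 ≡ a
[a+2q]%2≡a {a} q a≤1 = begin
  (a + 2 * q) % 2 ≡⟨ cong (λ n → (a + n) % 2) (*-comm 2 q) ⟩
  (a + q * 2) % 2 ≡⟨ [m+kn]%n≡m%n a q 2 ⟩
  a % 2           ≡⟨ m<n⇒m%n≡m (s≤s a≤1) ⟩
  a               ∎
  where open ≡-Reasoning

[a+2q]/2≡q : ∀ {a} q → a ≤ 1 → (a + 2 * q) / 2 ≡ q
[a+2q]/2≡q {a} q a≤1 = begin
  (a + 2 * q) / 2   ≡⟨ cong (λ n → (a + n) / 2) (*-comm 2 q) ⟩
  (a + q * 2) / 2   ≡⟨ +-distrib-/ a (q * 2) no-carry ⟩
  a / 2 + q * 2 / 2 ≡⟨ cong₂ _+_ (m<n⇒m/n≡0 (s≤s a≤1)) (m*n/n≡m q 2) ⟩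
  q                 ∎
  where
  open ≡-Reasoning
  no-carry : a % 2 + q * 2 % 2 < 2
  no-carry = subst (_< 2) (sym (cong₂ _+_ (m<n⇒m%n≡m (s≤s a≤1)) (m*n%n≡0 q 2)))
                   (s≤s (≤-trans (≤-reflexive (+-identityʳ a)) a≤1))

⌊n/2⌋≡n/2 : ∀ n → ⌊ n /2⌋ ≡ n / 2
⌊n/2⌋≡n/2 zero          = refl
⌊n/2⌋≡n/2 (suc zero)    = refl
⌊n/2⌋≡n/2 (suc (suc n)) = trans (cong suc (⌊n/2⌋≡n/2 n)) (sym (m/n≡1+[m∸n]/n {suc (suc n)} {2} (s≤s (s≤s z≤n))))

⌊log₂[a+2q]⌋ : ∀ {a} q → .{{NonZero q}} → a ≤ 1 → ⌊log₂ (a + 2 * q) ⌋ ≡ suc ⌊log₂ q ⌋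
⌊log₂[a+2q]⌋ {a} q@(suc _) a≤1 = begin
  ⌊log₂ n ⌋               ≡⟨ m∸n+n≡m (⌊log₂⌋-mono-≤ {2} {n} 2≤n) ⟨
  ⌊log₂ n ⌋ ∸ 1 + 1       ≡⟨ +-comm (⌊log₂ n ⌋ ∸ 1) 1 ⟩
  suc (⌊log₂ n ⌋ ∸ 1)     ≡⟨ cong suc (⌊log₂⌊n/2⌋⌋≡⌊log₂n⌋∸1 n) ⟨
  suc ⌊log₂ ⌊ n /2⌋ ⌋     ≡⟨ cong (λ x → suc ⌊log₂ x ⌋) (trans (⌊n/2⌋≡n/2 n) ([a+2q]/2≡q q a≤1)) ⟩
  suc ⌊log₂ q ⌋           ∎
  where
  open ≡-Reasoning
  n = a + 2 * q
  2≤n : 2 ≤ n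
  2≤n = ≤-trans (*-monoʳ-≤ 2 (s≤s z≤n)) (m≤n+m (2 * q) a)

height : ℕ → ℕ
height N = ⌊log₂ suc N ⌋

1+N≡a+2[1+m] : ∀ a m → suc (suc (a + 2 * m)) ≡ a + 2 * suc m
1+N≡a+2[1+m] = solve-∀

cc-cons-zero : ∀ {a} m → a ≤ 1 → cc (suc (a + 2 * m)) 0 ≡ suc a
cc-cons-zero {a} m a≤1 =
  trans (cong (λ n → n % 2 + 1) (1+N≡a+2[1+m] a m)) (trans (cong (_+ 1) ([a+2q]%2≡a (suc m) a≤1)) (+-comm a 1))

cc-cons-suc : ∀ {a} m → a ≤ 1 → ∀ j → cc (suc (a + 2 * m)) (suc j) ≡ cc m j
cc-cons-suc {a} m a≤1 j =
  cong (λ n → bit n j + 1) (trans (cong (_/ 2) (1+N≡a+2[1+m] a m)) ([a+2q]/2≡q (suc m) a≤1))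

height-cons : ∀ {a} m → a ≤ 1 → height (suc (a + 2 * m)) ≡ suc (height m)
height-cons {a} m a≤1 = trans (cong ⌊log₂_⌋ (1+N≡a+2[1+m] a m)) (⌊log₂[a+2q]⌋ (suc m) a≤1)

sumBelow : ℕ → (ℕ → ℕ) → ℕ
sumBelow zero    f = 0
sumBelow (suc n) f = f 0 + sumBelow n (f ∘ suc)

sumBelow-cong : ∀ n {f g} → f ≗ g → sumBelow n f ≡ sumBelow n g
sumBelow-cong zero    f≗g = refl
sumBelow-cong (suc n) f≗g = cong₂ _+_ (f≗g 0) (sumBelow-cong n (f≗g ∘ suc))

sumBelow-+ : ∀ n f g → sumBelow n (λ j → f j + g j) ≡ sumBelow n f + sumBelow n g
sumBelow-+ zero    f g = refl
sumBelow-+ (suc n) f g = trans (cong (f 0 + g 0 +_) (sumBelow-+ n (f ∘ suc) (g ∘ suc))) (interchange (f 0) (g 0) _ _)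
  where
  interchange : ∀ a b x y → a + b + (x + y) ≡ a + x + (b + y)
  interchange = solve-∀

sumBelow-* : ∀ n c f → sumBelow n (λ j → c * f j) ≡ c * sumBelow n f
sumBelow-* zero    c f = sym (*-zeroʳ c)
sumBelow-* (suc n) c f = trans (cong (c * f 0 +_) (sumBelow-* n c (f ∘ suc))) (sym (*-distribˡ-+ c (f 0) _))

sum1≡sumBelow : ∀ n f → sum1 n f ≡ sumBelow n (f ∘ suc)
sum1≡sumBelow zero    f = refl
sum1≡sumBelow (suc n) f = trans (cong (_+ f (suc n)) (sum1≡sumBelow n f)) (sym (sumBelow-snoc n (f ∘ suc)))
  where
  sumBelow-snoc : ∀ n g → sumBelow (suc n) g ≡ sumBelow n g + g n
  sumBelow-snoc zero    g = +-comm (g 0) 0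
  sumBelow-snoc (suc n) g = trans (cong (g 0 +_) (sumBelow-snoc n (g ∘ suc))) (sym (+-assoc (g 0) _ _))

digitSum : ℕ → ℕ
digitSum P = sumBelow (height P) (cc P)

digitValue : ℕ → ℕ
digitValue P = sumBelow (height P) λ j → 2 ^ j * cc P j

digitMoment : ℕ → ℕ
digitMoment P = sumBelow (height P) λ j → j * 2 ^ suc j * cc P j

module _ {a : ℕ} (m : ℕ) (a≤1 : a ≤ 1) where

  private
    N = suc (a + 2 * m)

    sumBelow-height : ∀ f → sumBelow (height N) f ≡ f 0 + sumBelow (height m) (f ∘ suc)
    sumBelow-height f = cong (λ n → sumBelow n f) (height-cons m a≤1)

  digitSum-cons : digitSum N ≡ suc a + digitSum m
  digitSum-cons = trans (sumBelow-height (cc N))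
    (cong₂ _+_ (cc-cons-zero m a≤1) (sumBelow-cong (height m) (cc-cons-suc m a≤1)))

  digitValue-cons : digitValue N ≡ suc a + 2 * digitValue m
  digitValue-cons = trans (sumBelow-height λ j → 2 ^ j * cc N j) (cong₂ _+_
    (trans (+-identityʳ (cc N 0)) (cc-cons-zero m a≤1))
    (trans (sumBelow-cong (height m) λ j →
             trans (cong (2 ^ suc j *_) (cc-cons-suc m a≤1 j)) (*-assoc 2 (2 ^ j) (cc m j)))
           (sumBelow-* (height m) 2 λ j → 2 ^ j * cc m j)))

  digitMoment-cons : digitMoment N ≡ 2 * digitMoment m + 4 * digitValue m
  digitMoment-cons = begin
    digitMoment N
      ≡⟨ sumBelow-height (λ j → j * 2 ^ suc j * cc N j) ⟩
    sumBelow (height m) (λ j → suc j * 2 ^ suc (suc j) * cc N (suc j))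
      ≡⟨ sumBelow-cong (height m) (λ j → trans (cong (suc j * 2 ^ suc (suc j) *_) (cc-cons-suc m a≤1 j))
                                              (expand j (2 ^ j) (cc m j))) ⟩
    sumBelow (height m) (λ j → 2 * (j * 2 ^ suc j * cc m j) + 4 * (2 ^ j * cc m j))
      ≡⟨ sumBelow-+ (height m) (λ j → 2 * (j * 2 ^ suc j * cc m j)) (λ j → 4 * (2 ^ j * cc m j)) ⟩
    sumBelow (height m) (λ j → 2 * (j * 2 ^ suc j * cc m j)) + sumBelow (height m) (λ j → 4 * (2 ^ j * cc m j))
      ≡⟨ cong₂ _+_ (sumBelow-* (height m) 2 _) (sumBelow-* (height m) 4 _) ⟩
    2 * digitMoment m + 4 * digitValue m ∎
    where
    open ≡-Reasoning
    expand : ∀ j x c → suc j * (2 * (2 * x)) * c ≡ 2 * (j * (2 * x) * c) + 4 * (x * c)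
    expand = solve-∀

  formula-cons : formula N ≡ digitMoment m + digitSum m
  formula-cons = begin
    formula N
      ≡⟨ cong (λ n → sum1 n term) (cong pred (height-cons m a≤1)) ⟩
    sum1 (height m) term
      ≡⟨ sum1≡sumBelow (height m) term ⟩
    sumBelow (height m) (term ∘ suc)
      ≡⟨ sumBelow-cong (height m) (λ j → trans (cong ((j * 2 ^ suc j + 1) *_) (cc-cons-suc m a≤1 j))
                                                (*-distribʳ-+ (cc m j) (j * 2 ^ suc j) 1)) ⟩
    sumBelow (height m) (λ j → j * 2 ^ suc j * cc m j + 1 * cc m j)
      ≡⟨ sumBelow-+ (height m) (λ j → j * 2 ^ suc j * cc m j) (λ j → 1 * cc m j) ⟩
    digitMoment m + sumBelow (height m) (λ j → 1 * cc m j)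
      ≡⟨ cong (digitMoment m +_) (sumBelow-cong (height m) λ j → *-identityˡ (cc m j)) ⟩
    digitMoment m + digitSum m ∎
    where
    open ≡-Reasoning
    term : ℕ → ℕ
    term k = ((k ∸ 1) * 2 ^ k + 1) * cc N k

digitValue≡ : ∀ {P} → Binary P → digitValue P ≡ P
digitValue≡ zero              = refl
digitValue≡ (cons {a} {m} a≤1 b) = trans (digitValue-cons m a≤1) (cong (λ v → suc a + 2 * v) (digitValue≡ b))

digitMoment-identity : ∀ {P} → Binary P → digitMoment P + 2 * digitSum P ≡ 2 * P + 2 * formula P
digitMoment-identity zero                 = refl
digitMoment-identity (cons {a} {m} a≤1 b) = begin
  digitMoment N + 2 * digitSum N
    ≡⟨ cong₂ (λ x y → x + 2 * y) (digitMoment-cons m a≤1) (digitSum-cons m a≤1) ⟩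
  2 * digitMoment m + 4 * digitValue m + 2 * (suc a + digitSum m)
    ≡⟨ cong (λ v → 2 * digitMoment m + 4 * v + 2 * (suc a + digitSum m)) (digitValue≡ b) ⟩
  2 * digitMoment m + 4 * m + 2 * (suc a + digitSum m)
    ≡⟨ regroup (digitMoment m) m a (digitSum m) ⟩
  2 * N + 2 * (digitMoment m + digitSum m)
    ≡⟨ cong (λ f → 2 * N + 2 * f) (formula-cons m a≤1) ⟨
  2 * N + 2 * formula N ∎
  where
  open ≡-Reasoning
  N = suc (a + 2 * m)
  regroup : ∀ x m a s → 2 * x + 4 * m + 2 * (suc a + s) ≡ 2 * suc (a + 2 * m) + 2 * (x + s)
  regroup = solve-∀

initialLayers : ℕ → LayerConfig
initialLayers N = withRoot N λ _ → 0

schedule : ∀ {N} → Binary N → List ℕ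
schedule zero               = []
schedule (cons {m = m} _ b) = replicate m 0 ++ lift (schedule b)

stableLayers : ∀ {N} → Binary N → LayerConfig
stableLayers zero               = λ _ → 0
stableLayers (cons {a} _ b)     = withRoot (suc a) (stableLayers b)

stableLayers-≤2 : ∀ {N} (b : Binary N) j → stableLayers b j ≤ 2
stableLayers-≤2 zero           j       = z≤n
stableLayers-≤2 (cons a≤1 b)   zero    = s≤s a≤1
stableLayers-≤2 (cons a≤1 b)   (suc j) = stableLayers-≤2 b j

schedule-reaches : ∀ {N} (b : Binary N) → Reaches (initialLayers N) (schedule b) (stableLayers b)
schedule-reaches zero = done , λ { zero → refl ; (suc j) → refl }
schedule-reaches (cons {a} {m} a≤1 b) =
  Reaches-++ (Reaches-cong start (fireRoot-repeatedly m (suc a) 0 (s≤s z≤n)))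
             (lift-correct (schedule b) (s≤s z≤n) (schedule-reaches b))
  where
  start : initialLayers (suc (a + 2 * m)) ≗ twoLayers (suc a + 2 * m) 0
  start zero          = refl
  start (suc zero)    = refl
  start (suc (suc j)) = refl

rootFires : List ℕ → ℕ
rootFires []           = 0
rootFires (zero  ∷ ks) = suc (rootFires ks)
rootFires (suc _ ∷ ks) = rootFires ks

rootFires-++ : ∀ ks ls → rootFires (ks ++ ls) ≡ rootFires ks + rootFires ls
rootFires-++ []           ls = refl
rootFires-++ (zero  ∷ ks) ls = cong suc (rootFires-++ ks ls)
rootFires-++ (suc _ ∷ ks) ls = rootFires-++ ks ls

rootFires-replicate : ∀ m → rootFires (replicate m 0) ≡ m
rootFires-replicate zero    = refl
rootFires-replicate (suc m) = cong suc (rootFires-replicate m)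

rootFires-lift : ∀ ks → rootFires (lift ks) ≡ rootFires ks
rootFires-lift []           = refl
rootFires-lift (zero  ∷ ks) = cong suc (rootFires-lift ks)
rootFires-lift (suc _ ∷ ks) = rootFires-lift ks

weight-++ : ∀ ks ls → weight (ks ++ ls) ≡ weight ks + weight ls
weight-++ []       ls = refl
weight-++ (k ∷ ks) ls = trans (cong (2 ^ k +_) (weight-++ ks ls)) (sym (+-assoc (2 ^ k) _ _))

weight-replicate : ∀ m → weight (replicate m 0) ≡ m
weight-replicate zero    = refl
weight-replicate (suc m) = cong suc (weight-replicate m)

weight-lift : ∀ ks → weight (lift ks) ≡ 2 * weight ks + rootFires ks
weight-lift []           = refl
weight-lift (zero  ∷ ks) = trans (cong (λ w → 2 + (1 + w)) (weight-lift ks)) (regroup (weight ks) (rootFires ks))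
  where
  regroup : ∀ w r → 2 + (1 + (2 * w + r)) ≡ 2 * (1 + w) + suc r
  regroup = solve-∀
weight-lift (suc k ∷ ks) = trans (cong (2 ^ suc (suc k) +_) (weight-lift ks)) (regroup (2 ^ k) (weight ks) (rootFires ks))
  where
  regroup : ∀ x w r → 2 * (2 * x) + (2 * w + r) ≡ 2 * (2 * x + w) + r
  regroup = solve-∀

rootFires-schedule : ∀ {N} (b : Binary N) → rootFires (schedule b) + digitSum N ≡ N
rootFires-schedule zero                 = refl
rootFires-schedule (cons {a} {m} a≤1 b) = begin
  rootFires (replicate m 0 ++ lift (schedule b)) + digitSum (suc (a + 2 * m))
    ≡⟨ cong₂ _+_ (trans (rootFires-++ (replicate m 0) (lift (schedule b)))
                        (cong₂ _+_ (rootFires-replicate m) (rootFires-lift (schedule b))))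
                 (digitSum-cons m a≤1) ⟩
  m + rootFires (schedule b) + (suc a + digitSum m)
    ≡⟨ regroup m (rootFires (schedule b)) a (digitSum m) ⟩
  suc (a + m + (rootFires (schedule b) + digitSum m))
    ≡⟨ cong (λ x → suc (a + m + x)) (rootFires-schedule b) ⟩
  suc (a + m + m)
    ≡⟨ cong suc (+-assoc a m m) ⟩
  suc (a + (m + m))
    ≡⟨ cong (λ x → suc (a + (m + x))) (+-identityʳ m) ⟨
  suc (a + 2 * m) ∎
  where
  open ≡-Reasoning
  regroup : ∀ m r a s → m + r + (suc a + s) ≡ suc (a + m + (r + s))
  regroup = solve-∀

weight-schedule : ∀ {N} (b : Binary N) → weight (schedule b) ≡ formula N
weight-schedule zero                 = refl
weight-schedule (cons {a} {m} a≤1 b) = +-cancelʳ-≡ (digitSum m) _ _ (begin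
  weight (replicate m 0 ++ lift (schedule b)) + digitSum m
    ≡⟨ cong (_+ digitSum m) (trans (weight-++ (replicate m 0) (lift (schedule b)))
                                   (cong₂ _+_ (weight-replicate m) (weight-lift (schedule b)))) ⟩
  m + (2 * weight (schedule b) + rootFires (schedule b)) + digitSum m
    ≡⟨ cong (λ w → m + (2 * w + rootFires (schedule b)) + digitSum m) (weight-schedule b) ⟩
  m + (2 * formula m + rootFires (schedule b)) + digitSum m
    ≡⟨ regroup m (formula m) (rootFires (schedule b)) (digitSum m) ⟩
  m + 2 * formula m + (rootFires (schedule b) + digitSum m)
    ≡⟨ cong (m + 2 * formula m +_) (rootFires-schedule b) ⟩
  m + 2 * formula m + m
    ≡⟨ regroup′ m (formula m) ⟩
  2 * m + 2 * formula m
    ≡⟨ digitMoment-identity b ⟨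
  digitMoment m + 2 * digitSum m
    ≡⟨ regroup″ (digitMoment m) (digitSum m) ⟩
  digitMoment m + digitSum m + digitSum m
    ≡⟨ cong (_+ digitSum m) (formula-cons m a≤1) ⟨
  formula (suc (a + 2 * m)) + digitSum m ∎)
  where
  open ≡-Reasoning
  regroup : ∀ m f r s → m + (2 * f + r) + s ≡ m + 2 * f + (r + s)
  regroup = solve-∀
  regroup′ : ∀ m f → m + 2 * f + m ≡ 2 * m + 2 * f
  regroup′ = solve-∀
  regroup″ : ∀ x s → x + 2 * s ≡ x + s + s
  regroup″ = solve-∀

initial-layered : ∀ N → Layered (initial N) (initialLayers N)
initial-layered N []      = refl
initial-layered N (_ ∷ _) = refl

mainTheorem18 : (N : ℕ) → 1 ≤ N →
    Σ (List Vertex) (λ vs → Stabilizing (initial N) vs)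
    × ((vs : List Vertex) → Stabilizing (initial N) vs → length vs ≡ formula N)
mainTheorem18 N _ = (fires , legal , stable) , λ vs stabilizing → begin
  length vs                          ≡⟨ stabilizing-length stabilizing (legal , stable) ⟩
  length fires                       ≡⟨ length-concatMap-layer (schedule b) ⟩
  weight (schedule b)                ≡⟨ weight-schedule b ⟩
  formula N                          ∎
  where
  open ≡-Reasoning
  b = binary N
  fires = concatMap layer (schedule b)
  reaches = schedule-reaches b
  simulated = simulate (initial-layered N) (proj₁ reaches)
  legal : Legal (initial N) fires
  legal = proj₁ simulated
  stable : Stable (run (initial N) fires)
  stable w = s≤s (subst (_≤ 2) (sym (trans (proj₂ simulated w) (proj₂ reaches (length w))))
                                 (stableLayers-≤2 b (length w)))
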